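{- Let $G$ be an elementary abelian $2$-group of rank $5$ and let $\mathcal{A}$ be a $2$-S-ring over $G$. Suppose that $\mathcal{A}$ is decomposable and $|\mathrm{O}_\theta(\mathcal{A})|=8$. Then $\mathcal{A}$ is cyclotomic.
   Context: For a finite group $G$ with identity $e$ and $X\subseteq G$ let $\underline{X}=\sum_{x\in X}x$. An S-ring over $G$ is a subring $\mathcal{A}\subseteq\mathbb{Z}G$ for which there is a partition $\mathcal{S}(\mathcal{A})$ of $G$ (basic sets) with $\{e\}\in\mathcal{S}(\mathcal{A})$, closed under inversion, and $\mathcal{A}=\mathrm{Span}_{\mathbb{Z}}\{\underline{X}:X\in\mathcal{S}(\mathcal{A})\}$. A $2$-S-ring over a $2$-group is an S-ring all of whose basic sets have $2$-power size. $\mathrm{O}_\theta(\mathcal{A})=\{x\in G:\{x\}\in\mathcal{S}(\mathcal{A})\}$. An $\mathcal{A}$-subgroup is a subgroup $H$ with $\underline H\in\mathcal{A}$; $\mathrm{rad}(X)=\{g: gX=Xg=X\}$. $\mathcal{A}$ is decomposable if there are $\mathcal{A}$-subgroups $L\le U$ with $L\trianglelefteq G$, $L\ne\{e\}$, $U\ne G$, such that $L\le\mathrm{rad}(X)$ for every basic set $X\not\subseteq U$. $\mathcal{A}$ is cyclotomic if there is $K\le\mathrm{Aut}(G)$ such that $\mathcal{S}(\mathcal{A})$ is the set of orbits of $K$ on $G$. -}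

module Defs where

open import Data.Bool using (Bool; true; false; _xor_; _∧_; if_then_else_)
open import Data.Bool.Properties using () renaming (_≟_ to _≟B_)
open import Data.Nat using (ℕ; zero; suc; _^_; _≡ᵇ_)
open import Data.Vec using (Vec; []; _∷_; zipWith; replicate)
open import Data.Vec.Properties using (≡-dec)
open import Data.List using (List; []; _∷_; _++_; map; concatMap)
open import Data.Product using (Σ; ∃; _×_; _,_; proj₁; proj₂)
open import Relation.Binary.PropositionalEquality using (_≡_)
open import Relation.Nullary using (¬_)
open import Relation.Nullary.Decidable using (⌊_⌋)
open import Function using (_∘_; _⇔_)

Gr : ℕ → Set
Gr n = Vec Bool n

G : Set
G = Gr 5

_·_ : G → G → G
_·_ = zipWith _xor_

e : G
e = replicate 5 false

inv : G → G
inv x = x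

_==_ : G → G → Bool
x == y = ⌊ ≡-dec _≟B_ x y ⌋

allVec : (n : ℕ) → List (Gr n)
allVec zero = [] ∷ []
allVec (suc n) = map (false ∷_) (allVec n) ++ map (true ∷_) (allVec n)

allG : List G
allG = allVec 5

count : {A : Set} → (A → Bool) → List A → ℕ
count p [] = 0
count p (a ∷ as) = if p a then suc (count p as) else count p as

pairs : List (G × G)
pairs = concatMap (λ u → map (λ v → (u , v)) allG) allG

-- A partition of G is given by a labelling  lab : G → ℕ ; the basic sets
-- are the (nonempty) fibres, i.e. the basic set containing x is
--   X(x) = { y | lab y ≡ lab x }.

Labelling : Set
Labelling = G → ℕ

size : Labelling → G → ℕ
size lab x = count (λ y → lab y ≡ᵇ lab x) allG

-- coefficient of z in  X(x)_ · X(y)_  ∈ ℤG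
coef : Labelling → G → G → G → ℕ
coef lab x y z =
  count (λ p → (lab (proj₁ p) ≡ᵇ lab x) ∧ ((lab (proj₂ p) ≡ᵇ lab y) ∧ ((proj₁ p · proj₂ p) == z))) pairs

-- The ℤ-span of the basic-set sums is a subring of ℤG with the given
-- partition as basic sets: {e} is a basic set, the partition is closed
-- under inversion, and each product X_·Y_ lies in the span, i.e. its
-- coefficients are constant on every basic set.
IsSRing : Labelling → Set
IsSRing lab =
  (∀ y → lab y ≡ lab e → y ≡ e) ×
  (∀ x y → lab x ≡ lab y → lab (inv x) ≡ lab (inv y)) ×
  (∀ x y z z′ → lab z ≡ lab z′ → coef lab x y z ≡ coef lab x y z′)

Is2SRing : Labelling → Set
Is2SRing lab = IsSRing lab × (∀ x → ∃ λ k → size lab x ≡ 2 ^ k)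

Otheta-size : Labelling → ℕ
Otheta-size lab = count (λ x → size lab x ≡ᵇ 1) allG

record IsSubgroup (H : G → Bool) : Set where
  field
    has-e   : H e ≡ true
    mul-cl  : ∀ x y → H x ≡ true → H y ≡ true → H (x · y) ≡ true
    inv-cl  : ∀ x → H x ≡ true → H (inv x) ≡ true

-- H_ ∈ A  iff H is a union of basic sets
IsASubgroup : Labelling → (G → Bool) → Set
IsASubgroup lab H =
  IsSubgroup H × (∀ x y → lab x ≡ lab y → H x ≡ true → H y ≡ true)

IsNormal : (G → Bool) → Set
IsNormal H = ∀ g x → H x ≡ true → H ((g · x) · inv g) ≡ true

InRad : Labelling → G → G → Set
InRad lab x g =
  (∀ y → (lab (inv g · y) ≡ lab x) ⇔ (lab y ≡ lab x)) ×
  (∀ y → (lab (y · inv g) ≡ lab x) ⇔ (lab y ≡ lab x))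

Decomposable : Labelling → Set
Decomposable lab =
  Σ (G → Bool) λ L → Σ (G → Bool) λ U →
    IsASubgroup lab L × IsASubgroup lab U ×
    (∀ g → L g ≡ true → U g ≡ true) ×
    IsNormal L ×
    (∃ λ l → L l ≡ true × ¬ (l ≡ e)) ×
    (∃ λ g → U g ≡ false) ×
    (∀ x → ¬ (∀ y → lab y ≡ lab x → U y ≡ true) →
       ∀ l → L l ≡ true → InRad lab x l)

record Aut : Set where
  field
    fwd   : G → G
    bwd   : G → G
    left  : ∀ x → bwd (fwd x) ≡ x
    right : ∀ x → fwd (bwd x) ≡ x
    hom   : ∀ x y → fwd (x · y) ≡ fwd x · fwd y

open Aut public

record IsAutSubgroup (K : Aut → Set) : Set where
  field
    has-id  : Σ Aut λ φ → K φ × (∀ x → fwd φ x ≡ x)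
    comp-cl : ∀ φ ψ → K φ → K ψ →
              Σ Aut λ χ → K χ × (∀ x → fwd χ x ≡ fwd φ (fwd ψ x))
    inv-cl  : ∀ φ → K φ →
              Σ Aut λ χ → K χ × (∀ x → fwd χ x ≡ bwd φ x)

Cyclotomic : Labelling → Set₁
Cyclotomic lab =
  Σ (Aut → Set) λ K → IsAutSubgroup K ×
    (∀ x y → (lab x ≡ lab y) ⇔ (Σ Aut λ φ → K φ × fwd φ x ≡ y))

module Submission where

-- The thin elements (those forming singleton basic sets) are closed under multiplication,
-- because translation by a thin element permutes the basic sets; so they form a subgroup T
-- of order 8 and G/T ≅ (ℤ/2)². If x and y lie in one basic set, translation by x·y keeps
-- every element of the coset xT inside its basic set. Using the S-ring condition once more
-- one finds v₁, v₂ whose combinations D(c) do the same on every coset c, with D(xT) = x·y.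
-- Then z ↦ z·D(zT) is a basic-set-preserving automorphism taking x to y: it is additive
-- because G is elementary abelian, and bijective because the map it induces on
-- G/T ≅ (ℤ/2)² is injective, hence of order dividing 6. So the basic sets are the orbits
-- of the group of basic-set-preserving automorphisms.

open import Data.Bool using (Bool; true; false; _xor_; _∧_; _∨_; if_then_else_)
open import Data.Bool.Properties using (xor-assoc; xor-comm; xor-identityˡ; xor-identityʳ; xor-same; ∧-conicalˡ; ∧-conicalʳ; ∨-conicalˡ; ∨-conicalʳ; ¬-not; not-¬)
  renaming (_≟_ to _≟B_)
open import Data.Nat using (ℕ; zero; suc; _+_; _*_; _≤_; _<_; z≤n; s≤s; s≤s⁻¹; _≡ᵇ_; _≤?_; _<?_)
open import Data.Nat.Properties using (+-comm; +-suc; m≤n⇒m≤1+n; ≤-trans; ≤-reflexive; module ≤-Reasoning)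
import Data.Nat.Properties as ℕ
open import Data.Vec using (Vec; []; _∷_; zipWith; replicate)
open import Data.Vec.Properties using (≡-dec; zipWith-assoc; zipWith-identityˡ; zipWith-identityʳ)
open import Data.List using (List; []; _∷_; _++_; map; length; concatMap)
open import Data.Bool.ListAction using (any)
open import Data.List.Relation.Unary.All as All using (All; []; _∷_)
open import Data.List.Relation.Unary.AllPairs using (AllPairs; []; _∷_)
open import Data.List.Membership.Propositional using (_∈_)
open import Data.List.Membership.Propositional.Properties using (∈-++⁺ˡ; ∈-++⁺ʳ; ∈-map⁺; ∈-concatMap⁺)
open import Data.List.Relation.Unary.Any as Any using (here; there)
open import Data.Product using (Σ; ∃; ∃₂; _×_; _,_; proj₁; proj₂)
open import Data.Empty using (⊥-elim)
open import Relation.Binary.Definitions using (DecidableEquality)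
open import Relation.Binary.PropositionalEquality
open import Relation.Nullary using (Dec; does; _because_; yes; no; contradiction)
open import Relation.Nullary.Reflects using (invert)
open import Relation.Nullary.Decidable using (isYes≗does; dec-true; dec-false; does-⇔; from-yes; from-no)
open import Function using (_⇔_; mk⇔)
open import Defs
open import Function.Endo.Propositional (Gr 2) using (_^_)

dec-true⁻¹ : {A : Set} (a? : Dec A) → does a? ≡ true → A
dec-true⁻¹ (true because [a]) _ = invert [a]

module _ {A : Set} where

  count-++ : (p : A → Bool) (xs ys : List A) → count p (xs ++ ys) ≡ count p xs + count p ys
  count-++ p [] ys = refl
  count-++ p (a ∷ xs) ys with p a
  ... | true = cong suc (count-++ p xs ys)
  ... | false = count-++ p xs ys

  count-cong : {p q : A → Bool} → (∀ x → p x ≡ q x) → (xs : List A) → count p xs ≡ count q xs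
  count-cong p≗q [] = refl
  count-cong {p} {q} p≗q (a ∷ xs) rewrite p≗q a with q a
  ... | true = cong suc (count-cong p≗q xs)
  ... | false = count-cong p≗q xs

  count-false : (xs : List A) → count (λ _ → false) xs ≡ 0
  count-false [] = refl
  count-false (a ∷ xs) = count-false xs

  count≤length : (p : A → Bool) (xs : List A) → count p xs ≤ length xs
  count≤length p [] = z≤n
  count≤length p (a ∷ xs) with p a
  ... | true = s≤s (count≤length p xs)
  ... | false = m≤n⇒m≤1+n (count≤length p xs)

  count-mono : {p q : A → Bool} → (∀ x → p x ≡ true → q x ≡ true) → (xs : List A) →
               count p xs ≤ count q xs
  count-mono p⇒q [] = z≤n
  count-mono {p} {q} p⇒q (a ∷ xs) with p a in pa
  ... | true rewrite p⇒q a pa = s≤s (count-mono p⇒q xs)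
  ... | false with q a
  ...   | true = m≤n⇒m≤1+n (count-mono p⇒q xs)
  ...   | false = count-mono p⇒q xs

  count-∨ : {p q : A → Bool} → (∀ x → p x ≡ true → q x ≡ false) → (xs : List A) →
            count (λ x → p x ∨ q x) xs ≡ count p xs + count q xs
  count-∨ disjoint [] = refl
  count-∨ {p} {q} disjoint (a ∷ xs) with p a in pa
  ... | true rewrite disjoint a pa = cong suc (count-∨ disjoint xs)
  ... | false with q a
  ...   | true = trans (cong suc (count-∨ disjoint xs)) (sym (+-suc _ _))
  ...   | false = count-∨ disjoint xs

  count≢0⇒witness : (p : A → Bool) (xs : List A) → count p xs ≢ 0 → ∃ λ x → p x ≡ true
  count≢0⇒witness p [] c≢0 = ⊥-elim (c≢0 refl)
  count≢0⇒witness p (a ∷ xs) c≢0 with p a in pa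
  ... | true = a , pa
  ... | false = count≢0⇒witness p xs c≢0

  count<length⇒witness : (p : A → Bool) (xs : List A) → count p xs < length xs → ∃ λ x → p x ≡ false
  count<length⇒witness p (a ∷ xs) c<l with p a in pa
  ... | true = count<length⇒witness p xs (s≤s⁻¹ c<l)
  ... | false = a , pa

  witness⇒count≢0 : (p : A → Bool) {xs : List A} {x : A} → x ∈ xs → p x ≡ true → count p xs ≢ 0
  witness⇒count≢0 p {a ∷ xs} (here refl) px rewrite px = λ ()
  witness⇒count≢0 p {a ∷ xs} (there x∈xs) px with p a
  ... | true = λ ()
  ... | false = witness⇒count≢0 p x∈xs px

count-map : {A B : Set} (p : B → Bool) (f : A → B) (xs : List A) →
            count p (map f xs) ≡ count (λ x → p (f x)) xs
count-map p f [] = refl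
count-map p f (a ∷ xs) with p (f a)
... | true = cong suc (count-map p f xs)
... | false = count-map p f xs

module _ {A : Set} (p : A → Bool) where

  any≡true⇒witness : (xs : List A) → any p xs ≡ true → ∃ λ x → p x ≡ true
  any≡true⇒witness (x ∷ xs) any≡true with p x in px
  ... | true = x , px
  ... | false = any≡true⇒witness xs any≡true

  any≡false⇒All : (xs : List A) → any p xs ≡ false → All (λ x → p x ≡ false) xs
  any≡false⇒All [] _ = []
  any≡false⇒All (x ∷ xs) any≡false =
    ∨-conicalˡ (p x) _ any≡false ∷ any≡false⇒All xs (∨-conicalʳ (p x) _ any≡false)

infixl 6 _⊕_

_⊕_ : ∀ {n} → Gr n → Gr n → Gr n
_⊕_ = zipWith _xor_

𝟎 : ∀ {n} → Gr n
𝟎 = replicate _ false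

⊕-comm : ∀ {n} (x y : Gr n) → x ⊕ y ≡ y ⊕ x
⊕-comm [] [] = refl
⊕-comm (a ∷ x) (b ∷ y) = cong₂ _∷_ (xor-comm a b) (⊕-comm x y)

x⊕x≡𝟎 : ∀ {n} (x : Gr n) → x ⊕ x ≡ 𝟎
x⊕x≡𝟎 [] = refl
x⊕x≡𝟎 (a ∷ x) = cong₂ _∷_ (xor-same a) (x⊕x≡𝟎 x)

module _ {n : ℕ} where

  ⊕-assoc : (x y z : Gr n) → (x ⊕ y) ⊕ z ≡ x ⊕ (y ⊕ z)
  ⊕-assoc = zipWith-assoc xor-assoc

  ⊕-identityˡ : (x : Gr n) → 𝟎 ⊕ x ≡ x
  ⊕-identityˡ = zipWith-identityˡ xor-identityˡ

  ⊕-identityʳ : (x : Gr n) → x ⊕ 𝟎 ≡ x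
  ⊕-identityʳ = zipWith-identityʳ xor-identityʳ

  x⊕[x⊕y]≡y : (x y : Gr n) → x ⊕ (x ⊕ y) ≡ y
  x⊕[x⊕y]≡y x y = begin
    x ⊕ (x ⊕ y)  ≡⟨ ⊕-assoc x x y ⟨
    (x ⊕ x) ⊕ y  ≡⟨ cong (_⊕ y) (x⊕x≡𝟎 x) ⟩
    𝟎 ⊕ y        ≡⟨ ⊕-identityˡ y ⟩
    y            ∎
    where open ≡-Reasoning

  x⊕[y⊕x]≡y : (x y : Gr n) → x ⊕ (y ⊕ x) ≡ y
  x⊕[y⊕x]≡y x y = trans (cong (x ⊕_) (⊕-comm y x)) (x⊕[x⊕y]≡y x y)

  [x⊕y]⊕y≡x : (x y : Gr n) → (x ⊕ y) ⊕ y ≡ x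
  [x⊕y]⊕y≡x x y = begin
    (x ⊕ y) ⊕ y  ≡⟨ ⊕-assoc x y y ⟩
    x ⊕ (y ⊕ y)  ≡⟨ cong (x ⊕_) (x⊕x≡𝟎 y) ⟩
    x ⊕ 𝟎        ≡⟨ ⊕-identityʳ x ⟩
    x            ∎
    where open ≡-Reasoning

  ⊕-interchange : (w x y z : Gr n) → (w ⊕ x) ⊕ (y ⊕ z) ≡ (w ⊕ y) ⊕ (x ⊕ z)
  ⊕-interchange w x y z = begin
    (w ⊕ x) ⊕ (y ⊕ z)  ≡⟨ ⊕-assoc w x (y ⊕ z) ⟩
    w ⊕ (x ⊕ (y ⊕ z))  ≡⟨ cong (w ⊕_) (⊕-assoc x y z) ⟨
    w ⊕ ((x ⊕ y) ⊕ z)  ≡⟨ cong (λ t → w ⊕ (t ⊕ z)) (⊕-comm x y) ⟩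
    w ⊕ ((y ⊕ x) ⊕ z)  ≡⟨ cong (w ⊕_) (⊕-assoc y x z) ⟩
    w ⊕ (y ⊕ (x ⊕ z))  ≡⟨ ⊕-assoc w y (x ⊕ z) ⟨
    (w ⊕ y) ⊕ (x ⊕ z)  ∎
    where open ≡-Reasoning

  [x⊕z]⊕[y⊕z]≡x⊕y : (x y z : Gr n) → (x ⊕ z) ⊕ (y ⊕ z) ≡ x ⊕ y
  [x⊕z]⊕[y⊕z]≡x⊕y x y z = begin
    (x ⊕ z) ⊕ (y ⊕ z)  ≡⟨ ⊕-interchange x z y z ⟩
    (x ⊕ y) ⊕ (z ⊕ z)  ≡⟨ cong ((x ⊕ y) ⊕_) (x⊕x≡𝟎 z) ⟩
    (x ⊕ y) ⊕ 𝟎        ≡⟨ ⊕-identityʳ (x ⊕ y) ⟩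
    x ⊕ y              ∎
    where open ≡-Reasoning

  ⊕-cancelʳ : {x y : Gr n} (z : Gr n) → x ⊕ z ≡ y ⊕ z → x ≡ y
  ⊕-cancelʳ {x} {y} z eq = begin
    x            ≡⟨ [x⊕y]⊕y≡x x z ⟨
    (x ⊕ z) ⊕ z  ≡⟨ cong (_⊕ z) eq ⟩
    (y ⊕ z) ⊕ z  ≡⟨ [x⊕y]⊕y≡x y z ⟩
    y            ∎
    where open ≡-Reasoning

combine : ∀ {k n} → Vec (Gr n) k → Gr k → Gr n
combine [] [] = 𝟎
combine (v ∷ vs) (b ∷ bs) = (if b then v else 𝟎) ⊕ combine vs bs

combine-𝟎 : ∀ {k n} (vs : Vec (Gr n) k) → combine vs 𝟎 ≡ 𝟎
combine-𝟎 [] = refl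
combine-𝟎 (v ∷ vs) = trans (⊕-identityˡ _) (combine-𝟎 vs)

combine-⊕ : ∀ {k n} (vs : Vec (Gr n) k) (c c′ : Gr k) → combine vs (c ⊕ c′) ≡ combine vs c ⊕ combine vs c′
combine-⊕ [] [] [] = sym (⊕-identityˡ 𝟎)
combine-⊕ {n = n} (v ∷ vs) (b ∷ c) (b′ ∷ c′) = begin
  select (b xor b′) ⊕ combine vs (c ⊕ c′)
    ≡⟨ cong₂ _⊕_ (select-xor b b′) (combine-⊕ vs c c′) ⟩
  (select b ⊕ select b′) ⊕ (combine vs c ⊕ combine vs c′)
    ≡⟨ ⊕-interchange (select b) (select b′) (combine vs c) (combine vs c′) ⟩
  (select b ⊕ combine vs c) ⊕ (select b′ ⊕ combine vs c′) ∎
  where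
  open ≡-Reasoning
  select : Bool → Gr n
  select b = if b then v else 𝟎
  select-xor : ∀ b b′ → select (b xor b′) ≡ select b ⊕ select b′
  select-xor false false = sym (⊕-identityˡ 𝟎)
  select-xor false true = sym (⊕-identityˡ v)
  select-xor true false = sym (⊕-identityʳ v)
  select-xor true true = sym (x⊕x≡𝟎 v)

⊕≡𝟎⇒≡ : ∀ {n} {x y : Gr n} → x ⊕ y ≡ 𝟎 → x ≡ y
⊕≡𝟎⇒≡ {x = x} {y} x⊕y≡𝟎 = ⊕-cancelʳ y (trans x⊕y≡𝟎 (sym (x⊕x≡𝟎 y)))

pattern c₀₀ = false ∷ false ∷ []
pattern c₀₁ = false ∷ true ∷ []
pattern c₁₀ = true ∷ false ∷ []
pattern c₁₁ = true ∷ true ∷ []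

Gr₂-elim : (P : Gr 2 → Set) → P c₀₀ → P c₀₁ → P c₁₀ → P c₁₁ → ∀ c → P c
Gr₂-elim P p₀₀ p₀₁ p₁₀ p₁₁ c₀₀ = p₀₀
Gr₂-elim P p₀₀ p₀₁ p₁₀ p₁₁ c₀₁ = p₀₁
Gr₂-elim P p₀₀ p₀₁ p₁₀ p₁₁ c₁₀ = p₁₀
Gr₂-elim P p₀₀ p₀₁ p₁₀ p₁₁ c₁₁ = p₁₁

^-cong : {f g : Gr 2 → Gr 2} → (∀ x → f x ≡ g x) → ∀ n x → (f ^ n) x ≡ (g ^ n) x
^-cong f≗g zero x = refl
^-cong {f} {g} f≗g (suc n) x = trans (f≗g _) (cong g (^-cong f≗g n x))

-- GL(2, 2) ≅ S₃ has exponent 6; a singular matrix is refuted by a vector of its kernel.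
combine₂-order-divides-6 : ∀ p q → (∀ c → combine (p ∷ q ∷ []) c ≡ 𝟎 → c ≡ 𝟎) →
                           ∀ c → (combine (p ∷ q ∷ []) ^ 6) c ≡ c
combine₂-order-divides-6 c₀₀ q ker = contradiction (ker c₁₀ refl) λ ()
combine₂-order-divides-6 p c₀₀ ker = contradiction (ker c₀₁ refl) λ ()
combine₂-order-divides-6 c₀₁ c₀₁ ker = contradiction (ker c₁₁ refl) λ ()
combine₂-order-divides-6 c₁₀ c₁₀ ker = contradiction (ker c₁₁ refl) λ ()
combine₂-order-divides-6 c₁₁ c₁₁ ker = contradiction (ker c₁₁ refl) λ ()
combine₂-order-divides-6 c₀₁ c₁₀ _ = Gr₂-elim _ refl refl refl refl
combine₂-order-divides-6 c₀₁ c₁₁ _ = Gr₂-elim _ refl refl refl refl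
combine₂-order-divides-6 c₁₀ c₀₁ _ = Gr₂-elim _ refl refl refl refl
combine₂-order-divides-6 c₁₀ c₁₁ _ = Gr₂-elim _ refl refl refl refl
combine₂-order-divides-6 c₁₁ c₀₁ _ = Gr₂-elim _ refl refl refl refl
combine₂-order-divides-6 c₁₁ c₁₀ _ = Gr₂-elim _ refl refl refl refl

module _ (f : Gr 2 → Gr 2) (f-⊕ : ∀ x y → f (x ⊕ y) ≡ f x ⊕ f y) where

  hom-𝟎 : f 𝟎 ≡ 𝟎
  hom-𝟎 = begin
    f 𝟎                  ≡⟨ ⊕-identityʳ (f 𝟎) ⟨
    f 𝟎 ⊕ 𝟎              ≡⟨ cong (f 𝟎 ⊕_) (x⊕x≡𝟎 (f 𝟎)) ⟨
    f 𝟎 ⊕ (f 𝟎 ⊕ f 𝟎)    ≡⟨ cong (f 𝟎 ⊕_) (f-⊕ 𝟎 𝟎) ⟨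
    f 𝟎 ⊕ f 𝟎            ≡⟨ x⊕x≡𝟎 (f 𝟎) ⟩
    𝟎                    ∎
    where open ≡-Reasoning

  hom₂≡combine : ∀ c → f c ≡ combine (f c₁₀ ∷ f c₀₁ ∷ []) c
  hom₂≡combine = Gr₂-elim _ hom-𝟎
    (sym (trans (⊕-identityˡ _) (⊕-identityʳ _)))
    (sym (⊕-identityʳ _))
    (trans (f-⊕ c₁₀ c₀₁) (cong (f c₁₀ ⊕_) (sym (⊕-identityʳ _))))

  automorphism₂-order-divides-6 : (∀ c → f c ≡ 𝟎 → c ≡ 𝟎) → ∀ c → (f ^ 6) c ≡ c
  automorphism₂-order-divides-6 ker c =
    trans (^-cong hom₂≡combine 6 c)
      (combine₂-order-divides-6 _ _ (λ c′ Mc′≡𝟎 → ker c′ (trans (hom₂≡combine c′) Mc′≡𝟎)) c)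

infix 4 _≟_

_≟_ : ∀ {n} → DecidableEquality (Gr n)
_≟_ = ≡-dec _≟B_

allVec-complete : ∀ n (x : Gr n) → x ∈ allVec n
allVec-complete zero [] = here refl
allVec-complete (suc n) (false ∷ x) = ∈-++⁺ˡ (∈-map⁺ _ (allVec-complete n x))
allVec-complete (suc n) (true ∷ x) = ∈-++⁺ʳ (map (false ∷_) (allVec n)) (∈-map⁺ _ (allVec-complete n x))

count-allVec-suc : ∀ n (P : Gr (suc n) → Bool) →
  count P (allVec (suc n)) ≡ count (λ w → P (false ∷ w)) (allVec n) + count (λ w → P (true ∷ w)) (allVec n)
count-allVec-suc n P = begin
  count P (map (false ∷_) (allVec n) ++ map (true ∷_) (allVec n))
    ≡⟨ count-++ P (map (false ∷_) (allVec n)) (map (true ∷_) (allVec n)) ⟩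
  count P (map (false ∷_) (allVec n)) + count P (map (true ∷_) (allVec n))
    ≡⟨ cong₂ _+_ (count-map P (false ∷_) (allVec n)) (count-map P (true ∷_) (allVec n)) ⟩
  count (λ w → P (false ∷ w)) (allVec n) + count (λ w → P (true ∷ w)) (allVec n) ∎
  where open ≡-Reasoning

count-translate : ∀ n (c : Gr n) (P : Gr n → Bool) →
  count (λ v → P (c ⊕ v)) (allVec n) ≡ count P (allVec n)
count-translate zero [] P = refl
count-translate (suc n) (false ∷ c) P =
  trans (count-allVec-suc n _)
    (trans (cong₂ _+_ (count-translate n c (λ w → P (false ∷ w))) (count-translate n c (λ w → P (true ∷ w))))
      (sym (count-allVec-suc n P)))
count-translate (suc n) (true ∷ c) P =
  trans (count-allVec-suc n _)
    (trans (+-comm (count (λ w → P (true ∷ c ⊕ w)) (allVec n)) _)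
      (trans (cong₂ _+_ (count-translate n c (λ w → P (false ∷ w))) (count-translate n c (λ w → P (true ∷ w))))
        (sym (count-allVec-suc n P))))

count-≟ : ∀ n (x : Gr n) → count (λ v → does (v ≟ x)) (allVec n) ≡ 1
count-≟ zero [] = refl
count-≟ (suc n) (false ∷ x) =
  trans (count-allVec-suc n _) (cong₂ _+_ (count-≟ n x) (count-false (allVec n)))
count-≟ (suc n) (true ∷ x) =
  trans (count-allVec-suc n _) (cong₂ _+_ (count-false (allVec n)) (count-≟ n x))

-- allG behind an opaque name: the conversion checker would otherwise unfold counts over the
-- concrete 32 elements (or 1024 pairs), at exponential cost.
opaque
  elements : List G
  elements = allG

opaque
  unfolding elements

  allG≡elements : allG ≡ elements
  allG≡elements = refl

elementPairs : List (G × G)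
elementPairs = concatMap (λ u → map (λ v → (u , v)) elements) elements

pairs≡elementPairs : pairs ≡ elementPairs
pairs≡elementPairs = subst (λ L → pairs ≡ concatMap (λ u → map (λ v → (u , v)) L) L) allG≡elements refl

∈-elements : (x : G) → x ∈ elements
∈-elements x = subst (x ∈_) allG≡elements (allVec-complete 5 x)

∈-elementPairs : (u v : G) → (u , v) ∈ elementPairs
∈-elementPairs u v = ∈-concatMap⁺ (λ u′ → map (u′ ,_) elements)
  (Any.map (λ { refl → ∈-map⁺ (u ,_) (∈-elements v) }) (∈-elements u))

length-elements : length elements ≡ 32
length-elements = subst (λ L → length L ≡ 32) allG≡elements refl

count-elements-translate : (c : G) (P : G → Bool) → count (λ v → P (c · v)) elements ≡ count P elements
count-elements-translate = transport allG≡elements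
  where
  -- Instantiating count-translate at the concrete rank 5 triggers the same unfolding.
  transport : ∀ {n} {L : List (Gr n)} → allVec n ≡ L →
              (c : Gr n) (P : Gr n → Bool) → count (λ v → P (c ⊕ v)) L ≡ count P L
  transport refl = count-translate _

count-elements-≟ : (x : G) → count (λ v → does (v ≟ x)) elements ≡ 1
count-elements-≟ x = subst (λ L → count (λ v → does (v ≟ x)) L ≡ 1) allG≡elements (count-≟ 5 x)


module BasicSets (lab : Labelling) where

  Thin : G → Set
  Thin x = ∀ y → lab y ≡ lab x → y ≡ x

  InProduct : G → G → G → Set
  InProduct a b z = ∃₂ λ u v → lab u ≡ lab a × lab v ≡ lab b × u · v ≡ z

  Factors : G → G → G → G × G → Bool
  Factors a b z (u , v) = (lab u ≡ᵇ lab a) ∧ ((lab v ≡ᵇ lab b) ∧ ((u · v) == z))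

  size≡count-elements : ∀ x → size lab x ≡ count (λ y → lab y ≡ᵇ lab x) elements
  size≡count-elements x =
    subst (λ L → size lab x ≡ count (λ y → lab y ≡ᵇ lab x) L) allG≡elements refl

  -- Opaque: size unfolds to a count over allG (see elements).
  opaque
    thin? : G → Bool
    thin? x = size lab x ≡ᵇ 1

    Otheta-size≡count-thin? : Otheta-size lab ≡ count thin? elements
    Otheta-size≡count-thin? = subst (λ L → Otheta-size lab ≡ count (λ x → size lab x ≡ᵇ 1) L) allG≡elements refl

    thin?⇒size≡1 : ∀ {x} → thin? x ≡ true → size lab x ≡ 1
    thin?⇒size≡1 {x} = dec-true⁻¹ (size lab x ℕ.≟ 1)

    size≡1⇒thin? : ∀ {x} → size lab x ≡ 1 → thin? x ≡ true
    size≡1⇒thin? {x} = dec-true (size lab x ℕ.≟ 1)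

  coef≡count-elementPairs : ∀ a b z → coef lab a b z ≡ count (Factors a b z) elementPairs
  coef≡count-elementPairs a b z = subst
    (λ L → coef lab a b z ≡ count (λ p → (lab (proj₁ p) ≡ᵇ lab a) ∧ ((lab (proj₂ p) ≡ᵇ lab b) ∧ ((proj₁ p · proj₂ p) == z))) L)
    pairs≡elementPairs refl

  Thin⇒thin? : ∀ {x} → Thin x → thin? x ≡ true
  Thin⇒thin? {x} thin = size≡1⇒thin? (begin
    size lab x                             ≡⟨ size≡count-elements x ⟩
    count (λ y → lab y ≡ᵇ lab x) elements  ≡⟨ count-cong same-label⇔equal elements ⟩
    count (λ y → does (y ≟ x)) elements    ≡⟨ count-elements-≟ x ⟩
    1                                      ∎)
    where
    open ≡-Reasoning
    same-label⇔equal : ∀ y → (lab y ≡ᵇ lab x) ≡ does (y ≟ x)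
    same-label⇔equal y = does-⇔ (mk⇔ (thin y) (cong lab)) (lab y ℕ.≟ lab x) (y ≟ x)

  thin?⇒Thin : ∀ {x} → thin? x ≡ true → Thin x
  thin?⇒Thin {x} size≡1 y ly with y ≟ x
  ... | yes y≡x = y≡x
  ... | no y≢x = contradiction (≤-trans two≤count (≤-reflexive |X|≡1)) λ { (s≤s ()) }
    where
    |X|≡1 : count (λ v → lab v ≡ᵇ lab x) elements ≡ 1
    |X|≡1 = trans (sym (size≡count-elements x)) (thin?⇒size≡1 size≡1)
    x-or-y⇒same-label : ∀ v → (does (v ≟ x) ∨ does (v ≟ y)) ≡ true → (lab v ≡ᵇ lab x) ≡ true
    x-or-y⇒same-label v _ with v ≟ x | v ≟ y
    ... | yes refl | _ = dec-true (lab v ℕ.≟ lab v) refl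
    ... | no _ | yes refl = dec-true (lab v ℕ.≟ lab x) ly
    two≤count : 2 ≤ count (λ v → lab v ≡ᵇ lab x) elements
    two≤count = begin
      2                                                     ≡⟨ cong₂ _+_ (count-elements-≟ x) (count-elements-≟ y) ⟨
      count (λ v → does (v ≟ x)) elements + count (λ v → does (v ≟ y)) elements
        ≡⟨ count-∨ (λ v v≡x → dec-false (v ≟ y) λ v≡y → y≢x (trans (sym v≡y) (dec-true⁻¹ (v ≟ x) v≡x))) elements ⟨
      count (λ v → does (v ≟ x) ∨ does (v ≟ y)) elements  ≤⟨ count-mono x-or-y⇒same-label elements ⟩
      count (λ v → lab v ≡ᵇ lab x) elements                ∎
      where open ≤-Reasoning

  InProduct⇒coef≢0 : ∀ {a b z} → InProduct a b z → coef lab a b z ≢ 0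
  InProduct⇒coef≢0 {a} {b} (u , v , lu , lv , refl) =
    subst (_≢ 0) (sym (coef≡count-elementPairs a b (u · v)))
      (witness⇒count≢0 (Factors a b (u · v)) (∈-elementPairs u v) factors)
    where
    factors : Factors a b (u · v) (u , v) ≡ true
    factors = cong₂ _∧_ (dec-true (lab u ℕ.≟ lab a) lu)
      (cong₂ _∧_ (dec-true (lab v ℕ.≟ lab b) lv) (trans (isYes≗does (u · v ≟ u · v)) (dec-true (u · v ≟ u · v) refl)))

  coef≢0⇒InProduct : ∀ {a b z} → coef lab a b z ≢ 0 → InProduct a b z
  coef≢0⇒InProduct {a} {b} {z} coef≢0 =
    from-witness (count≢0⇒witness (Factors a b z) elementPairs (subst (_≢ 0) (coef≡count-elementPairs a b z) coef≢0))
    where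
    from-witness : (∃ λ p → Factors a b z p ≡ true) → InProduct a b z
    from-witness ((u , v) , factors) =
      u , v , dec-true⁻¹ (lab u ℕ.≟ lab a) (∧-conicalˡ _ _ factors) ,
      dec-true⁻¹ (lab v ℕ.≟ lab b) (∧-conicalˡ _ _ rest) ,
      dec-true⁻¹ (u · v ≟ z) (trans (sym (isYes≗does (u · v ≟ z))) (∧-conicalʳ (lab v ≡ᵇ lab b) _ rest))
      where
      rest : ((lab v ≡ᵇ lab b) ∧ ((u · v) == z)) ≡ true
      rest = ∧-conicalʳ (lab u ≡ᵇ lab a) _ factors

module SRing (lab : Labelling)
  (coef-constant : ∀ x y z z′ → lab z ≡ lab z′ → coef lab x y z ≡ coef lab x y z′) where

  open BasicSets lab

  InProduct-respects-lab : ∀ {a b z z′} → lab z ≡ lab z′ → InProduct a b z → InProduct a b z′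
  InProduct-respects-lab {a} {b} {z} {z′} z~z′ z∈ab =
    coef≢0⇒InProduct λ coef≡0 → InProduct⇒coef≢0 z∈ab (trans (coef-constant a b z z′ z~z′) coef≡0)

  thin-translation-respects-lab : ∀ {t z w} → Thin t → lab z ≡ lab w → lab (t · z) ≡ lab (t · w)
  thin-translation-respects-lab {t} {z} {w} thin z~w =
    factored (InProduct-respects-lab z~w (t , t · z , refl , refl , x⊕[x⊕y]≡y t z))
    where
    factored : InProduct t (t · z) w → lab (t · z) ≡ lab (t · w)
    factored (u , v , u~t , v~tz , uv≡w) = trans (sym v~tz) (cong lab v≡tw)
      where
      v≡tw : v ≡ t · w
      v≡tw = trans (sym (x⊕[x⊕y]≡y t v)) (cong (t ·_) (trans (cong (_· v) (sym (thin u u~t))) uv≡w))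

  Thin-· : ∀ {t s} → Thin t → Thin s → Thin (t · s)
  Thin-· {t} {s} thin-t thin-s y y~ts =
    trans (sym (x⊕[x⊕y]≡y t y)) (cong (t ·_) (thin-s (t · y) ty~s))
    where
    ty~s : lab (t · y) ≡ lab s
    ty~s = trans (thin-translation-respects-lab thin-t y~ts) (cong lab (x⊕[x⊕y]≡y t s))

module SubgroupOfIndex4 (H : G → Bool) (H-e : H e ≡ true)
  (H-· : ∀ {x y} → H x ≡ true → H y ≡ true → H (x · y) ≡ true)
  (|H|≡8 : count H elements ≡ 8) where

  InCosets : List G → G → Bool
  InCosets cs v = any (λ c → H (c · v)) cs

  Apart : G → G → Set
  Apart c d = H (c · d) ≡ false

  cosets-disjoint : ∀ {c d} → Apart c d → ∀ v → H (c · v) ≡ true → H (d · v) ≡ false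
  cosets-disjoint {c} {d} c∉dH v cv∈H = ¬-not λ dv∈H →
    not-¬ c∉dH (trans (cong H (sym ([x⊕z]⊕[y⊕z]≡x⊕y c d v))) (H-· cv∈H dv∈H))

  count-InCosets : ∀ {cs} → AllPairs Apart cs → count (InCosets cs) elements ≡ length cs * 8
  count-InCosets {[]} [] = count-false elements
  count-InCosets {c ∷ cs} (c-apart ∷ apart) = begin
    count (InCosets (c ∷ cs)) elements
      ≡⟨ count-∨ {p = λ v → H (c · v)} {q = InCosets cs} (outside c-apart) elements ⟩
    count (λ v → H (c · v)) elements + count (InCosets cs) elements
      ≡⟨ cong₂ _+_ (trans (count-elements-translate c H) |H|≡8) (count-InCosets apart) ⟩
    8 + length cs * 8 ∎
    where
    open ≡-Reasoning
    outside : ∀ {ds} → All (Apart c) ds → ∀ v → H (c · v) ≡ true → InCosets ds v ≡ false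
    outside [] v _ = refl
    outside (c-apart-d ∷ rest) v cv∈H = cong₂ _∨_ (cosets-disjoint c-apart-d v cv∈H) (outside rest v cv∈H)

  outside-cosets : ∀ {cs} → AllPairs Apart cs → length cs * 8 < 32 → ∃ λ v → InCosets cs v ≡ false
  outside-cosets {cs} apart small = count<length⇒witness (InCosets cs) elements
    (subst₂ _<_ (sym (count-InCosets apart)) (sym length-elements) small)

  outside-e : ∃ λ v → InCosets (e ∷ []) v ≡ false
  outside-e = outside-cosets ([] ∷ []) (from-yes (8 <? 32))

  a₁ : G
  a₁ = proj₁ outside-e

  a₁-apart : Apart e a₁
  a₁-apart = ∨-conicalˡ _ false (proj₂ outside-e)

  outside-e-a₁ : ∃ λ v → InCosets (e ∷ a₁ ∷ []) v ≡ false
  outside-e-a₁ = outside-cosets ((a₁-apart ∷ []) ∷ [] ∷ []) (from-yes (16 <? 32))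

  a₂ : G
  a₂ = proj₁ outside-e-a₁

  a₂-apart-e : Apart e a₂
  a₂-apart-e = ∨-conicalˡ _ _ (proj₂ outside-e-a₁)

  a₂-apart-a₁ : Apart a₁ a₂
  a₂-apart-a₁ = ∨-conicalˡ _ false (∨-conicalʳ (H (e · a₂)) _ (proj₂ outside-e-a₁))

  rep : Gr 2 → G
  rep = combine (a₁ ∷ a₂ ∷ [])

  rep∈H⇒𝟎 : ∀ c → H (rep c) ≡ true → c ≡ 𝟎
  rep∈H⇒𝟎 c₀₀ _ = refl
  rep∈H⇒𝟎 c₁₀ rep∈H = contradiction (subst (λ x → H x ≡ true) rep-c₁₀ rep∈H) (not-¬ a₁-apart)
    where
    rep-c₁₀ : rep c₁₀ ≡ e · a₁
    rep-c₁₀ = trans (⊕-identityʳ a₁) (sym (⊕-identityˡ a₁))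
  rep∈H⇒𝟎 c₀₁ rep∈H = contradiction (subst (λ x → H x ≡ true) rep-c₀₁ rep∈H) (not-¬ a₂-apart-e)
    where
    rep-c₀₁ : rep c₀₁ ≡ e · a₂
    rep-c₀₁ = cong (e ·_) (⊕-identityʳ a₂)
  rep∈H⇒𝟎 c₁₁ rep∈H = contradiction (subst (λ x → H x ≡ true) rep-c₁₁ rep∈H) (not-¬ a₂-apart-a₁)
    where
    rep-c₁₁ : rep c₁₁ ≡ a₁ · a₂
    rep-c₁₁ = cong (a₁ ·_) (⊕-identityʳ a₂)

  rep-apart : ∀ c d → c ⊕ d ≢ 𝟎 → Apart (rep c) (rep d)
  rep-apart c d c⊕d≢𝟎 = ¬-not λ rep-c·rep-d∈H →
    c⊕d≢𝟎 (rep∈H⇒𝟎 (c ⊕ d) (subst (λ x → H x ≡ true) (sym (combine-⊕ (a₁ ∷ a₂ ∷ []) c d)) rep-c·rep-d∈H))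

  reps : List G
  reps = map rep (allVec 2)

  reps-apart : AllPairs Apart reps
  reps-apart =
      (rep-apart c₀₀ c₀₁ (λ ()) ∷ rep-apart c₀₀ c₁₀ (λ ()) ∷ rep-apart c₀₀ c₁₁ (λ ()) ∷ [])
    ∷ (rep-apart c₀₁ c₁₀ (λ ()) ∷ rep-apart c₀₁ c₁₁ (λ ()) ∷ [])
    ∷ (rep-apart c₁₀ c₁₁ (λ ()) ∷ [])
    ∷ [] ∷ []

  -- Otherwise z and reps would give five disjoint cosets of size 8 in a group of order 32.
  covering : ∀ z → ∃ λ c → H (rep c · z) ≡ true
  covering z = by-cases (InCosets reps z) refl
    where
    by-cases : ∀ b → InCosets reps z ≡ b → ∃ λ c → H (rep c · z) ≡ true
    by-cases true z∈reps = any≡true⇒witness (λ c → H (rep c · z)) (allVec 2) z∈reps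
    by-cases false z∉reps = contradiction
      (subst₂ _≤_ (count-InCosets (z-apart ∷ reps-apart)) length-elements (count≤length _ elements))
      (from-no (40 ≤? 32))
      where
      z-apart : All (Apart z) reps
      z-apart = All.map (λ {c} cz∉H → trans (cong H (⊕-comm z c)) cz∉H) (any≡false⇒All (λ c → H (c · z)) reps z∉reps)

  -- Only the properties below are used; unfolding index makes conversion checks on
  -- iterated twists blow up.
  opaque
    index : G → Gr 2
    index z = proj₁ (covering z)

    rep-index-∈H : ∀ z → H (rep (index z) · z) ≡ true
    rep-index-∈H z = proj₂ (covering z)

  rep-𝟎 : ∀ z → rep 𝟎 · z ≡ z
  rep-𝟎 z = trans (cong (_· z) (combine-𝟎 (a₁ ∷ a₂ ∷ []))) (⊕-identityˡ z)

  index-unique : ∀ {c z} → H (rep c · z) ≡ true → index z ≡ c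
  index-unique {c} {z} rep-c·z∈H =
    ⊕≡𝟎⇒≡ (rep∈H⇒𝟎 (index z ⊕ c) (subst (λ x → H x ≡ true) same-coset (H-· (rep-index-∈H z) rep-c·z∈H)))
    where
    same-coset : (rep (index z) · z) · (rep c · z) ≡ rep (index z ⊕ c)
    same-coset = trans ([x⊕z]⊕[y⊕z]≡x⊕y _ _ z) (sym (combine-⊕ (a₁ ∷ a₂ ∷ []) (index z) c))

  index-· : ∀ z w → index (z · w) ≡ index z ⊕ index w
  index-· z w = index-unique (subst (λ x → H x ≡ true) rearranged (H-· (rep-index-∈H z) (rep-index-∈H w)))
    where
    rearranged : (rep (index z) · z) · (rep (index w) · w) ≡ rep (index z ⊕ index w) · (z · w)
    rearranged = trans (⊕-interchange _ z _ w) (cong (_· (z · w)) (sym (combine-⊕ (a₁ ∷ a₂ ∷ []) (index z) (index w))))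

  index≡𝟎⇒∈H : ∀ {z} → index z ≡ 𝟎 → H z ≡ true
  index≡𝟎⇒∈H {z} index≡𝟎 = subst (λ c → H c ≡ true) (trans (cong (λ c → rep c · z) index≡𝟎) (rep-𝟎 z)) (rep-index-∈H z)

  ∈H⇒index≡𝟎 : ∀ {z} → H z ≡ true → index z ≡ 𝟎
  ∈H⇒index≡𝟎 {z} z∈H = index-unique (subst (λ x → H x ≡ true) (sym (rep-𝟎 z)) z∈H)

  index-rep : ∀ c → index (rep c) ≡ c
  index-rep c = index-unique (subst (λ x → H x ≡ true) (sym (x⊕x≡𝟎 (rep c))) H-e)

PreservesBasicSets : Labelling → Aut → Set
PreservesBasicSets lab φ = ∀ z → lab (fwd φ z) ≡ lab z

id-aut : Aut
id-aut = record { fwd = λ x → x ; bwd = λ x → x ; left = λ _ → refl ; right = λ _ → refl ; hom = λ _ _ → refl }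

_∘-aut_ : Aut → Aut → Aut
φ ∘-aut ψ = record
  { fwd = λ x → fwd φ (fwd ψ x)
  ; bwd = λ x → bwd ψ (bwd φ x)
  ; left = λ x → trans (cong (bwd ψ) (left φ (fwd ψ x))) (left ψ x)
  ; right = λ x → trans (cong (fwd φ) (right ψ (bwd φ x))) (right φ x)
  ; hom = λ x y → trans (cong (fwd φ) (hom ψ x y)) (hom φ _ _)
  }

inverse-aut : Aut → Aut
inverse-aut φ = record
  { fwd = bwd φ
  ; bwd = fwd φ
  ; left = right φ
  ; right = left φ
  ; hom = λ x y → trans (cong (bwd φ) (sym (cong₂ _·_ (right φ x) (right φ y))))
                        (trans (cong (bwd φ) (sym (hom φ (bwd φ x) (bwd φ y)))) (left φ _))
  }

cyclotomic-if-transitive : (lab : Labelling) →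
  (∀ x y → lab x ≡ lab y → Σ Aut λ φ → PreservesBasicSets lab φ × fwd φ x ≡ y) → Cyclotomic lab
cyclotomic-if-transitive lab transitive = PreservesBasicSets lab , subgroup , orbits
  where
  subgroup : IsAutSubgroup (PreservesBasicSets lab)
  subgroup = record
    { has-id = id-aut , (λ _ → refl) , (λ _ → refl)
    ; comp-cl = λ φ ψ φ-pres ψ-pres → φ ∘-aut ψ , (λ z → trans (φ-pres (fwd ψ z)) (ψ-pres z)) , (λ _ → refl)
    ; inv-cl = λ φ φ-pres → inverse-aut φ , (λ z → trans (sym (φ-pres (bwd φ z))) (cong lab (right φ z))) , (λ _ → refl)
    }
  orbits : ∀ x y → (lab x ≡ lab y) ⇔ (Σ Aut λ φ → PreservesBasicSets lab φ × fwd φ x ≡ y)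
  orbits x y = mk⇔ (transitive x y) λ (φ , φ-pres , φx≡y) → trans (sym (φ-pres x)) (cong lab φx≡y)

module Cyclotomy (lab : Labelling) (e-thin : ∀ y → lab y ≡ lab e → y ≡ e)
  (coef-constant : ∀ x y z z′ → lab z ≡ lab z′ → coef lab x y z ≡ coef lab x y z′)
  (|Oθ|≡8 : Otheta-size lab ≡ 8) where

  open BasicSets lab
  open SRing lab coef-constant
  open SubgroupOfIndex4 thin? (Thin⇒thin? e-thin)
    (λ t s → Thin⇒thin? (Thin-· (thin?⇒Thin t) (thin?⇒Thin s)))
    (trans (sym Otheta-size≡count-thin?) |Oθ|≡8)

  PreservesOnCoset : Gr 2 → G → Set
  PreservesOnCoset c u = ∀ z → index z ≡ c → lab (z · u) ≡ lab z

  -- z·a is thin, and translation by a thin element maps basic sets to basic sets.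
  same-basic-set⇒PreservesOnCoset : ∀ {a b c} → lab a ≡ lab b → index a ≡ c → PreservesOnCoset c (a · b)
  same-basic-set⇒PreservesOnCoset {a} {b} a~b index-a≡c z index-z≡c = begin
    lab (z · (a · b))  ≡⟨ cong lab (⊕-assoc z a b) ⟨
    lab ((z · a) · b)  ≡⟨ thin-translation-respects-lab za-thin a~b ⟨
    lab ((z · a) · a)  ≡⟨ cong lab ([x⊕y]⊕y≡x z a) ⟩
    lab z              ∎
    where
    open ≡-Reasoning
    za-thin : Thin (z · a)
    za-thin = thin?⇒Thin (index≡𝟎⇒∈H (begin
      index (z · a)        ≡⟨ index-· z a ⟩
      index z ⊕ index a    ≡⟨ cong₂ _⊕_ index-z≡c index-a≡c ⟩
      _ ⊕ _                ≡⟨ x⊕x≡𝟎 _ ⟩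
      𝟎                    ∎))

  -- x = (x·z′)·z′ lies in X(x·z′)·X(z′), hence so does y = p₁·p₂; this splits x·y into the
  -- pieces (x·z′)·p₁ and z′·p₂, which lie in the cosets of x·z′ and z′.
  PreservesOnCoset-split : ∀ {x y c} → lab x ≡ lab y → index x ≡ c →
                ∀ c′ → ∃ λ u → PreservesOnCoset c′ u × PreservesOnCoset (c ⊕ c′) ((x · y) · u)
  PreservesOnCoset-split {x} {y} {c} x~y index-x≡c c′ = factored (InProduct-respects-lab x~y x∈product)
    where
    z′ : G
    z′ = rep c′
    x∈product : InProduct (x · z′) z′ x
    x∈product = x · z′ , z′ , refl , refl , [x⊕y]⊕y≡x x z′
    factored : InProduct (x · z′) z′ y → ∃ λ u → PreservesOnCoset c′ u × PreservesOnCoset (c ⊕ c′) ((x · y) · u)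
    factored (p₁ , p₂ , p₁~xz′ , p₂~z′ , p₁p₂≡y) =
      z′ · p₂ , same-basic-set⇒PreservesOnCoset (sym p₂~z′) (index-rep c′) ,
      subst (PreservesOnCoset (c ⊕ c′)) (sym regroup)
        (same-basic-set⇒PreservesOnCoset (sym p₁~xz′) (trans (index-· x z′) (cong₂ _⊕_ index-x≡c (index-rep c′))))
      where
      regroup : (x · y) · (z′ · p₂) ≡ (x · z′) · p₁
      regroup = begin
        (x · y) · (z′ · p₂)             ≡⟨ cong (λ w → (x · w) · (z′ · p₂)) p₁p₂≡y ⟨
        (x · (p₁ · p₂)) · (z′ · p₂)     ≡⟨ ⊕-interchange x (p₁ · p₂) z′ p₂ ⟩
        (x · z′) · ((p₁ · p₂) · p₂)     ≡⟨ cong ((x · z′) ·_) ([x⊕y]⊕y≡x p₁ p₂) ⟩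
        (x · z′) · p₁                   ∎
        where open ≡-Reasoning

  Frame : G → G → Set
  Frame v₁ v₂ = PreservesOnCoset c₁₀ v₁ × PreservesOnCoset c₀₁ v₂ × PreservesOnCoset c₁₁ (v₁ · v₂)

  PreservesOnCoset-e : ∀ c → PreservesOnCoset c e
  PreservesOnCoset-e c z _ = cong lab (⊕-identityʳ z)

  Frame⇒PreservesOnCoset : ∀ {v₁ v₂} → Frame v₁ v₂ → ∀ c → PreservesOnCoset c (combine (v₁ ∷ v₂ ∷ []) c)
  Frame⇒PreservesOnCoset {v₁} {v₂} (m₁₀ , m₀₁ , m₁₁) = Gr₂-elim _
    (PreservesOnCoset-e c₀₀)
    (subst (PreservesOnCoset c₀₁) (sym (trans (⊕-identityˡ _) (⊕-identityʳ v₂))) m₀₁)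
    (subst (PreservesOnCoset c₁₀) (sym (⊕-identityʳ v₁)) m₁₀)
    (subst (PreservesOnCoset c₁₁) (cong (v₁ ·_) (sym (⊕-identityʳ v₂))) m₁₁)

  frame-through : ∀ {x y} → lab x ≡ lab y →
    ∃₂ λ v₁ v₂ → Frame v₁ v₂ × combine (v₁ ∷ v₂ ∷ []) (index x) ≡ x · y
  frame-through {x} {y} x~y = by-index (index x) refl
    where
    by-index : ∀ c → index x ≡ c → ∃₂ λ v₁ v₂ → Frame v₁ v₂ × combine (v₁ ∷ v₂ ∷ []) c ≡ x · y
    by-index c₀₀ index-x≡𝟎 =
      e , e , (PreservesOnCoset-e c₁₀ , PreservesOnCoset-e c₀₁ , PreservesOnCoset-e c₁₁) ,
      sym (trans (cong (x ·_) (thin?⇒Thin (index≡𝟎⇒∈H index-x≡𝟎) y (sym x~y))) (x⊕x≡𝟎 x))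
    by-index c₁₀ index-x≡c = let u , m₀₁ , m₁₁ = PreservesOnCoset-split x~y index-x≡c c₀₁ in
      x · y , u , (same-basic-set⇒PreservesOnCoset x~y index-x≡c , m₀₁ , m₁₁) , ⊕-identityʳ (x · y)
    by-index c₀₁ index-x≡c = let u , m₁₀ , m₁₁ = PreservesOnCoset-split x~y index-x≡c c₁₀ in
      u , x · y ,
      (m₁₀ , same-basic-set⇒PreservesOnCoset x~y index-x≡c , subst (PreservesOnCoset c₁₁) (⊕-comm (x · y) u) m₁₁) ,
      trans (⊕-identityˡ _) (⊕-identityʳ (x · y))
    by-index c₁₁ index-x≡c = let u , m₁₀ , m₀₁ = PreservesOnCoset-split x~y index-x≡c c₁₀ in
      u , (x · y) · u ,
      (m₁₀ , m₀₁ , subst (PreservesOnCoset c₁₁) (sym (x⊕[y⊕x]≡y u (x · y)))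
                     (same-basic-set⇒PreservesOnCoset x~y index-x≡c)) ,
      trans (cong (u ·_) (⊕-identityʳ ((x · y) · u))) (x⊕[y⊕x]≡y u (x · y))

  module FrameAutomorphism {v₁ v₂ : G} (frame : Frame v₁ v₂) where

    D : Gr 2 → G
    D = combine (v₁ ∷ v₂ ∷ [])

    φ : G → G
    φ z = z · D (index z)

    twist : Gr 2 → Gr 2
    twist c = c ⊕ index (D c)

    index-φ : ∀ z → index (φ z) ≡ twist (index z)
    index-φ z = index-· z (D (index z))

    φ-preserves : ∀ z → lab (φ z) ≡ lab z
    φ-preserves z = Frame⇒PreservesOnCoset frame (index z) z refl

    twist-⊕ : ∀ c c′ → twist (c ⊕ c′) ≡ twist c ⊕ twist c′
    twist-⊕ c c′ = begin
      (c ⊕ c′) ⊕ index (D (c ⊕ c′))          ≡⟨ cong (λ w → (c ⊕ c′) ⊕ index w) (combine-⊕ (v₁ ∷ v₂ ∷ []) c c′) ⟩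
      (c ⊕ c′) ⊕ index (D c · D c′)          ≡⟨ cong ((c ⊕ c′) ⊕_) (index-· (D c) (D c′)) ⟩
      (c ⊕ c′) ⊕ (index (D c) ⊕ index (D c′)) ≡⟨ ⊕-interchange c c′ (index (D c)) (index (D c′)) ⟩
      twist c ⊕ twist c′                      ∎
      where open ≡-Reasoning

    twist-kernel : ∀ c → twist c ≡ 𝟎 → c ≡ 𝟎
    twist-kernel c twist-c≡𝟎 = begin
      c              ≡⟨ index-rep c ⟨
      index z        ≡⟨ ∈H⇒index≡𝟎 (Thin⇒thin? (subst Thin (sym z≡φz) φz-thin)) ⟩
      𝟎              ∎
      where
      open ≡-Reasoning
      z : G
      z = rep c
      φz-thin : Thin (φ z)
      φz-thin = thin?⇒Thin (index≡𝟎⇒∈H (trans (index-φ z) (trans (cong twist (index-rep c)) twist-c≡𝟎)))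
      z≡φz : z ≡ φ z
      z≡φz = φz-thin z (sym (φ-preserves z))

    -- twist is the map induced by φ on G/O_θ ≅ Gr 2; it is injective, so twist ^ 5 inverts it.
    ψ : G → G
    ψ z = z · D ((twist ^ 5) (index z))

    ψ∘φ : ∀ z → ψ (φ z) ≡ z
    ψ∘φ z = begin
      φ z · D ((twist ^ 5) (index (φ z)))       ≡⟨ cong (λ c → φ z · D ((twist ^ 5) c)) (index-φ z) ⟩
      φ z · D ((twist ^ 5) (twist (index z)))   ≡⟨ cong (λ c → φ z · D c) (automorphism₂-order-divides-6 twist twist-⊕ twist-kernel (index z)) ⟩
      (z · D (index z)) · D (index z)           ≡⟨ [x⊕y]⊕y≡x z (D (index z)) ⟩
      z                                         ∎
      where open ≡-Reasoning

    φ∘ψ : ∀ z → φ (ψ z) ≡ z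
    φ∘ψ z = trans (cong (λ c → ψ z · D c) index-ψ) ([x⊕y]⊕y≡x z (D n))
      where
      n : Gr 2
      n = (twist ^ 5) (index z)
      index-Dn : index (D n) ≡ n ⊕ index z
      index-Dn = trans (sym (x⊕[x⊕y]≡y n (index (D n)))) (cong (n ⊕_) (automorphism₂-order-divides-6 twist twist-⊕ twist-kernel (index z)))
      index-ψ : index (ψ z) ≡ n
      index-ψ = trans (index-· z (D n)) (trans (cong (index z ⊕_) index-Dn) (x⊕[y⊕x]≡y (index z) n))

    φ-· : ∀ z w → φ (z · w) ≡ φ z · φ w
    φ-· z w = begin
      (z · w) · D (index (z · w))               ≡⟨ cong (λ c → (z · w) · D c) (index-· z w) ⟩
      (z · w) · D (index z ⊕ index w)           ≡⟨ cong ((z · w) ·_) (combine-⊕ (v₁ ∷ v₂ ∷ []) (index z) (index w)) ⟩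
      (z · w) · (D (index z) · D (index w))     ≡⟨ ⊕-interchange z w (D (index z)) (D (index w)) ⟩
      φ z · φ w                                 ∎
      where open ≡-Reasoning

    automorphism : Aut
    automorphism = record { fwd = φ ; bwd = ψ ; left = ψ∘φ ; right = φ∘ψ ; hom = φ-· }

  transitive : ∀ x y → lab x ≡ lab y → Σ Aut λ φ → PreservesBasicSets lab φ × fwd φ x ≡ y
  transitive x y x~y =
    let v₁ , v₂ , frame , D[index-x]≡x·y = frame-through x~y
        open FrameAutomorphism frame
    in automorphism , φ-preserves , trans (cong (x ·_) D[index-x]≡x·y) (x⊕[x⊕y]≡y x y)

lemma8p6 : (lab : Labelling) → Is2SRing lab → Decomposable lab →
    Otheta-size lab ≡ 8 → Cyclotomic lab
lemma8p6 lab ((e-thin , _ , coef-constant) , _) _ |Oθ|≡8 =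
  cyclotomic-if-transitive lab (Cyclotomy.transitive lab e-thin coef-constant |Oθ|≡8)
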